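{- Let $N\geq 2$ and let $\rho$ be the unique positive real root of $X^N-X^{N-1}-\cdots-X-1$. Let $x\neq 0$ be a $\rho$-integer having a representation of degree $n\geq 0$. Then $x$ has a representation in normal form of degree $n$ or of degree $n+1$.
   Context: A non-negative real number $x$ is a $\rho$-integer if $x=\sum_{i=0}^{n}c_i\rho^{n-i}$ for some $n\in\mathbb N_0$ and coefficients $c_i\in\{0,1\}$; such an expression is a representation of $x$. If $x\neq0$ and $r$ is the smallest index with $c_r=1$, the representation has degree $n-r$ (i.e. the degree is the largest exponent of $\rho$ occurring with coefficient $1$). A representation $x=\rho^n+\sum_{i=1}^n c_i\rho^{n-i}$ (with $c_i\in\{0,1\}$) is in normal form if, setting $c_0=1$ and $c_k=0$ for $k>n$, one has $\prod_{k=j}^{j+N-1}c_k=0$ for all $j\geq 0$; i.e. every block of $N$ consecutive coefficients contains a zero. Such a normal form representation has degree $n$. -}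

module Defs where

open import Level using (Level)
open import Algebra.Bundles using (CommutativeRing)
open import Data.Bool using (Bool; true; false)
open import Data.Nat using (ℕ; zero; suc; _≤_) renaming (_+_ to _+ℕ_)
open import Data.List using (List; []; _∷_; length; take; drop)
open import Data.List.Relation.Unary.All using (All)
open import Data.Empty using (⊥)
open import Relation.Binary.PropositionalEquality using (_≡_)
open import Relation.Nullary using (¬_)

-- Degree of a 0/1 coefficient list c_0 … c_n (most significant first):
-- HasDegree cs d  iff some coefficient is 1 and, with r the smallest index
-- with c_r = 1, we have n - r = d (i.e. the number of coefficients after
-- the first 1 is d).
HasDegree : List Bool → ℕ → Set
HasDegree []           d = ⊥
HasDegree (false ∷ cs) d = HasDegree cs d
HasDegree (true ∷ cs)  d = length cs ≡ d

-- Blocks that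
-- run past the end automatically contain a zero (c_k = 0 for k > n), so only
-- blocks lying fully inside the list need to be checked.
NoRunOf : ℕ → List Bool → Set
NoRunOf N cs = ∀ j → j +ℕ N ≤ length cs → ¬ All (_≡ true) (take N (drop j cs))

-- Normal form representation  ρ^m + Σ c_i ρ^{m-i}:  the list  true ∷ cs
-- (c_0 = 1) with no N consecutive ones.
NormalForm : ℕ → List Bool → Set
NormalForm N cs = NoRunOf N (true ∷ cs)

module _ {c ℓ : Level} (R : CommutativeRing c ℓ) where
  open CommutativeRing R using (Carrier; _+_; _*_; 0#; 1#)

  pow : Carrier → ℕ → Carrier
  pow x zero    = 1#
  pow x (suc k) = x * pow x k

  geomSum : Carrier → ℕ → Carrier
  geomSum x zero    = 0#
  geomSum x (suc k) = pow x k + geomSum x k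

  bit : Bool → Carrier
  bit true  = 1#
  bit false = 0#

  eval : Carrier → List Bool → Carrier
  eval ρ []       = 0#
  eval ρ (b ∷ cs) = bit b * pow ρ (length cs) + eval ρ cs

{-# OPTIONS --safe #-}
-- Prepend a 0 to a degree-n representation 1d and apply carries 0 1ᴺ ↦ 1 0ᴺ while possible.
-- A carry keeps the length, keeps a 1 among the first two digits, and keeps the value since
-- ρᴺ = 1 + ρ + … + ρᴺ⁻¹; it lowers the number of ones, so the process ends in a word without
-- the factor 0 1ᴺ. Such a word can contain N consecutive ones only at its very start. This is
-- excluded by weighting positions with N-bonacci numbers instead of powers of ρ: they satisfy
-- the same recurrence, so this weight is carry-invariant as well, while a leading block of N
-- ones outweighs every word one digit shorter, such as 1d.
module Submission where

open import Defs
open import Algebra.Bundles using (CommutativeRing; Semiring)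
open import Data.Bool using (Bool; true; false)
open import Data.Nat as ℕ using (ℕ; zero; suc; _≤_; _<_; z≤n; s≤s)
open import Data.Nat.Properties using (+-*-semiring; +-monoˡ-≤; suc-injective; <-irrefl)
open import Data.Nat.Induction using (<-wellFounded)
open import Data.Nat.ListAction using (sum)
open import Data.List using (List; []; _∷_; _++_; length; replicate; take)
open import Data.List.Properties using (length-++; length-replicate; ∷-injectiveʳ)
open import Data.List.Relation.Unary.All using (All; _∷_)
open import Data.Product using (Σ; _×_; _,_; ∃; ∃₂; map; map₂)
open import Data.Sum using (_⊎_; inj₁; inj₂)
import Data.Sum as Sum
open import Function using (_∘_; id)
open import Induction.WellFounded using (Acc; acc)
open import Level using (0ℓ)
open import Relation.Binary.Bundles using (Setoid)
open import Relation.Binary.Construct.Closure.ReflexiveTransitive using (Star; ε; _◅_; fold)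
open import Relation.Binary.Core using (Rel)
open import Relation.Binary.Definitions using (_Respects_)
open import Relation.Binary.PropositionalEquality as ≡ using (_≡_; refl; cong; cong₂)
open import Relation.Nullary using (¬_; Dec; yes; no)
open import Relation.Nullary.Decidable using (map′)
open import Relation.Unary using (Pred)

module _ {a r} {A : Set a} {T : Rel A r} where

  Star-respects : ∀ {p} (P : Pred A p) → P Respects T → P Respects Star T
  Star-respects P resp ε          = id
  Star-respects P resp (st ◅ sts) = Star-respects P resp sts ∘ resp st

  Star-invariant : ∀ {c ℓ} (S : Setoid c ℓ) (f : A → Setoid.Carrier S) →
                   (∀ {x y} → T x y → Setoid._≈_ S (f x) (f y)) →
                   ∀ {x y} → Star T x y → Setoid._≈_ S (f x) (f y)
  Star-invariant S f inv =
    fold (λ x y → Setoid._≈_ S (f x) (f y)) (Setoid.trans S ∘ inv) (Setoid.refl S)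

ones zeros : ℕ → List Bool
ones m  = replicate m true
zeros m = replicate m false

length-replicate-++ : ∀ {b : Bool} m w → length (replicate m b ++ w) ≡ m ℕ.+ length w
length-replicate-++ m w = ≡.trans (length-++ (replicate m _)) (cong (ℕ._+ length w) (length-replicate m))

true∷ones-++ : ∀ m w → true ∷ ones m ++ w ≡ ones m ++ true ∷ w
true∷ones-++ zero    w = refl
true∷ones-++ (suc m) w = cong (true ∷_) (true∷ones-++ m w)

data CarryStep (N : ℕ) : Rel (List Bool) 0ℓ where
  carry : ∀ w → CarryStep N (false ∷ ones N ++ w) (true ∷ zeros N ++ w)
  there : ∀ b {s t} → CarryStep N s t → CarryStep N (b ∷ s) (b ∷ t)

CarryStep* : ℕ → Rel (List Bool) 0ℓ
CarryStep* N = Star (CarryStep N)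

carry-length : ∀ {N s t} → CarryStep N s t → length s ≡ length t
carry-length {N} (carry w) =
  cong suc (≡.trans (length-replicate-++ N w) (≡.sym (length-replicate-++ N w)))
carry-length (there b st) = cong suc (carry-length st)

count-ones : List Bool → ℕ
count-ones []          = 0
count-ones (true ∷ s)  = suc (count-ones s)
count-ones (false ∷ s) = count-ones s

count-ones-ones-++ : ∀ m w → count-ones (ones m ++ w) ≡ m ℕ.+ count-ones w
count-ones-ones-++ zero    w = refl
count-ones-ones-++ (suc m) w = cong suc (count-ones-ones-++ m w)

count-ones-zeros-++ : ∀ m w → count-ones (zeros m ++ w) ≡ count-ones w
count-ones-zeros-++ zero    w = refl
count-ones-zeros-++ (suc m) w = count-ones-zeros-++ m w

carry-decreases : ∀ {N s t} → 2 ≤ N → CarryStep N s t → count-ones t < count-ones s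
carry-decreases {N} 2≤N (carry w)
  rewrite count-ones-zeros-++ N w | count-ones-ones-++ N w = +-monoˡ-≤ (count-ones w) 2≤N
carry-decreases 2≤N (there true  st) = s≤s (carry-decreases 2≤N st)
carry-decreases 2≤N (there false st) = carry-decreases 2≤N st

StartsWithRun : ℕ → List Bool → Set
StartsWithRun N s = ∃ λ w → s ≡ ones N ++ w

startsWithRun? : ∀ N s → Dec (StartsWithRun N s)
startsWithRun? zero    s           = yes (s , refl)
startsWithRun? (suc N) []          = no λ { (_ , ()) }
startsWithRun? (suc N) (false ∷ s) = no λ { (_ , ()) }
startsWithRun? (suc N) (true ∷ s)  =
  map′ (map₂ (cong (true ∷_))) (map₂ ∷-injectiveʳ) (startsWithRun? N s)

startsWithRun-∷ : ∀ {N s} → StartsWithRun N s → StartsWithRun N (true ∷ s)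
startsWithRun-∷ {N} (w , refl) = true ∷ w , true∷ones-++ N w

allOnes⇒startsWithRun : ∀ {N} s → N ≤ length s → All (_≡ true) (take N s) → StartsWithRun N s
allOnes⇒startsWithRun {zero}  s       _         _               = s , refl
allOnes⇒startsWithRun {suc N} (_ ∷ s) (s≤s N≤s) (refl ∷ allOnes) =
  map₂ (cong (true ∷_)) (allOnes⇒startsWithRun s N≤s allOnes)

CarryFree : ℕ → List Bool → Set
CarryFree N s = ∀ t → ¬ CarryStep N s t

carry-or-free : ∀ N s → ∃ (CarryStep N s) ⊎ CarryFree N s
carry-or-free N []          = inj₂ λ _ ()
carry-or-free N (true ∷ s)  =
  Sum.map (map (true ∷_) (there true)) (λ free → λ { _ (there _ st) → free _ st })
          (carry-or-free N s)
carry-or-free N (false ∷ s) with startsWithRun? N s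
... | yes (w , refl) = inj₁ (_ , carry w)
... | no ¬run =
  Sum.map (map (false ∷_) (there false))
          (λ free → λ { _ (carry w) → ¬run (w , refl) ; _ (there _ st) → free _ st })
          (carry-or-free N s)

normalise : ∀ {N} → 2 ≤ N → ∀ s → ∃ λ t → CarryStep* N s t × CarryFree N t
normalise {N} 2≤N s = go s (<-wellFounded (count-ones s))
  where
  go : ∀ s → Acc _<_ (count-ones s) → ∃ λ t → CarryStep* N s t × CarryFree N t
  go s (acc smaller) with carry-or-free N s
  ... | inj₂ free       = s , ε , free
  ... | inj₁ (s′ , step) =
    map₂ (map (step ◅_) id) (go s′ (smaller (carry-decreases 2≤N step)))

carryFree-noRun : ∀ {N} s → CarryFree N s → ¬ StartsWithRun N s → NoRunOf N s
carryFree-noRun s           _    ¬run zero    N≤s       = ¬run ∘ allOnes⇒startsWithRun s N≤s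
carryFree-noRun []          _    _    (suc j) ()
carryFree-noRun (true ∷ s)  free ¬run (suc j) (s≤s j+N≤s) =
  carryFree-noRun s (λ t → free _ ∘ there true) (¬run ∘ startsWithRun-∷) j j+N≤s
carryFree-noRun (false ∷ s) free _    (suc j) (s≤s j+N≤s) =
  carryFree-noRun s (λ t → free _ ∘ there false) (λ { (w , refl) → free _ (carry w) }) j j+N≤s

NoRunOf-tail : ∀ {N b s} → NoRunOf N (b ∷ s) → NoRunOf N s
NoRunOf-tail noRun j j+N≤s = noRun (suc j) (s≤s j+N≤s)

data OneInFirstTwo : List Bool → Set where
  1∷_  : ∀ s → OneInFirstTwo (true ∷ s)
  01∷_ : ∀ s → OneInFirstTwo (false ∷ true ∷ s)

oneInFirstTwo-carry : ∀ {N} → OneInFirstTwo Respects CarryStep N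
oneInFirstTwo-carry (carry w)                   _       = 1∷ _
oneInFirstTwo-carry (there true _)              _       = 1∷ _
oneInFirstTwo-carry (there false (there true _)) (01∷ _) = 01∷ _

HasDegree-view : ∀ ds {n} → HasDegree ds n → ∃₂ λ k d → ds ≡ zeros k ++ true ∷ d × length d ≡ n
HasDegree-view (true ∷ ds)  deg = 0 , ds , refl , deg
HasDegree-view (false ∷ ds) deg with HasDegree-view ds deg
... | k , d , refl , |d|≡n = suc k , d , refl , |d|≡n

module Positional {a ℓ} (S : Semiring a ℓ) where
  open Semiring S hiding (zero; refl)
  open import Relation.Binary.Reasoning.Setoid setoid

  digit : Bool → Carrier
  digit true  = 1#
  digit false = 0#

  value : (ℕ → Carrier) → List Bool → Carrier
  value f []      = 0#
  value f (b ∷ s) = digit b * f (length s) + value f s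

  sumFrom : (ℕ → Carrier) → ℕ → ℕ → Carrier
  sumFrom f k zero    = 0#
  sumFrom f k (suc m) = f (m ℕ.+ k) + sumFrom f k m

  Recurrent : ℕ → (ℕ → Carrier) → Set ℓ
  Recurrent N f = ∀ k → f (N ℕ.+ k) ≈ sumFrom f k N

  value-zeros-++ : ∀ f m w → value f (zeros m ++ w) ≈ value f w
  value-zeros-++ f zero    w = Setoid.refl setoid
  value-zeros-++ f (suc m) w = begin
    0# * f (length (zeros m ++ w)) + value f (zeros m ++ w) ≈⟨ +-congʳ (zeroˡ _) ⟩
    0# + value f (zeros m ++ w)                            ≈⟨ +-identityˡ _ ⟩
    value f (zeros m ++ w)                                 ≈⟨ value-zeros-++ f m w ⟩
    value f w                                              ∎

  value-ones-++ : ∀ f m w → value f (ones m ++ w) ≈ sumFrom f (length w) m + value f w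
  value-ones-++ f zero    w = sym (+-identityˡ _)
  value-ones-++ f (suc m) w = begin
    1# * f (length (ones m ++ w)) + value f (ones m ++ w)
      ≈⟨ +-cong (*-identityˡ _) (value-ones-++ f m w) ⟩
    f (length (ones m ++ w)) + (sumFrom f (length w) m + value f w)
      ≡⟨ cong (λ i → f i + (sumFrom f (length w) m + value f w)) (length-replicate-++ m w) ⟩
    f (m ℕ.+ length w) + (sumFrom f (length w) m + value f w)
      ≈⟨ +-assoc _ _ _ ⟨
    sumFrom f (length w) (suc m) + value f w
      ∎

  value-carry : ∀ {N f s t} → Recurrent N f → CarryStep N s t → value f s ≈ value f t
  value-carry {N} {f} recurrent (carry w) = begin
    value f (false ∷ ones N ++ w)                      ≈⟨ value-zeros-++ f 1 (ones N ++ w) ⟩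
    value f (ones N ++ w)                              ≈⟨ value-ones-++ f N w ⟩
    sumFrom f (length w) N + value f w                 ≈⟨ +-cong (recurrent (length w)) (value-zeros-++ f N w) ⟨
    f (N ℕ.+ length w) + value f (zeros N ++ w)        ≡⟨ cong (λ i → f i + value f (zeros N ++ w)) (length-replicate-++ N w) ⟨
    f (length (zeros N ++ w)) + value f (zeros N ++ w) ≈⟨ +-congʳ (*-identityˡ _) ⟨
    value f (true ∷ zeros N ++ w)                      ∎
  value-carry {f = f} recurrent (there b st) =
    +-cong (*-congˡ (reflexive (cong f (carry-length st)))) (value-carry recurrent st)

module NBonacciWeight where
  open import Data.Nat using (_+_)
  open import Data.Nat.Properties
    using (+-assoc; +-comm; +-suc; +-identityʳ; *-identityˡ; ≤-trans; ≤-reflexive;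
           m≤m+n; m≤n+m; +-mono-≤; +-monoʳ-<; module ≤-Reasoning)
  open Positional +-*-semiring
  open ≤-Reasoning

  mutual
    nbonacci : ℕ → ℕ → ℕ
    nbonacci N zero    = 1
    nbonacci N (suc k) = sum (take N (history N (suc k)))

    history : ℕ → ℕ → List ℕ
    history N zero    = []
    history N (suc k) = nbonacci N k ∷ history N k

  sum-take-history : ∀ N m k → sum (take m (history N (m + k))) ≡ sumFrom (nbonacci N) k m
  sum-take-history N zero    k = refl
  sum-take-history N (suc m) k = cong (nbonacci N (m + k) +_) (sum-take-history N m k)

  nbonacci-recurrent : ∀ N → Recurrent (suc N) (nbonacci (suc N))
  nbonacci-recurrent N = sum-take-history (suc N) (suc N)

  nbonacci-positive : ∀ N k → 0 < nbonacci (suc N) k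
  nbonacci-positive N zero    = s≤s z≤n
  nbonacci-positive N (suc k) = ≤-trans (nbonacci-positive N k) (m≤m+n _ _)

  head≤sumFrom : ∀ f k m → f k ≤ sumFrom f k (suc m)
  head≤sumFrom f k zero    = m≤m+n (f k) 0
  head≤sumFrom f k (suc m) = ≤-trans (head≤sumFrom f k m) (m≤n+m _ (f (suc m + k)))

  sumFrom-+ : ∀ f k m j → sumFrom f k (m + j) ≡ sumFrom f (k + j) m + sumFrom f k j
  sumFrom-+ f k zero    j = refl
  sumFrom-+ f k (suc m) j = ≡.trans
    (cong₂ _+_ (cong f (≡.trans (+-assoc m j k) (cong (m +_) (+-comm j k))))
               (sumFrom-+ f k m j))
    (≡.sym (+-assoc (f (m + (k + j))) _ _))

  value-≤-sumFrom : ∀ f s → value f s ≤ sumFrom f 0 (length s)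
  value-≤-sumFrom f []          = z≤n
  value-≤-sumFrom f (true ∷ s)  =
    +-mono-≤ (≤-reflexive (≡.trans (*-identityˡ _) (cong f (≡.sym (+-identityʳ _)))))
             (value-≤-sumFrom f s)
  value-≤-sumFrom f (false ∷ s) = ≤-trans (value-≤-sumFrom f s) (m≤n+m _ _)

  module _ (M : ℕ) where
    private
      N = suc (suc M)
      F = nbonacci N

    partialSum<nbonacci : ∀ K → sumFrom F 0 K < F (suc M + K)
    partialSum<nbonacci zero    = nbonacci-positive (suc M) (suc M + 0)
    partialSum<nbonacci (suc K) = begin-strict
      F (K + 0) + sumFrom F 0 K            <⟨ +-monoʳ-< (F (K + 0)) (partialSum<nbonacci K) ⟩
      F (K + 0) + F (suc M + K)            ≡⟨ cong (λ i → F i + F (suc M + K)) (+-identityʳ K) ⟩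
      F K + F (suc M + K)                  ≤⟨ +-monoˡ-≤ (F (suc M + K)) (head≤sumFrom F K M) ⟩
      sumFrom F K (suc M) + F (suc M + K)  ≡⟨ +-comm (sumFrom F K (suc M)) _ ⟩
      sumFrom F K N                        ≡⟨ nbonacci-recurrent (suc M) K ⟨
      F (N + K)                            ≡⟨ cong F (+-suc (suc M) K) ⟨
      F (suc M + suc K)                    ∎

    run-outweighs : ∀ p {t} → StartsWithRun N t → length t ≡ suc (length p) → value F p < value F t
    run-outweighs p (w , refl) |t|≡ = begin-strict
      value F p                            ≤⟨ value-≤-sumFrom F p ⟩
      sumFrom F 0 (length p)               ≡⟨ cong (sumFrom F 0) |p|≡ ⟩
      sumFrom F 0 (suc M + K)              ≡⟨ sumFrom-+ F 0 (suc M) K ⟩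
      sumFrom F K (suc M) + sumFrom F 0 K  <⟨ +-monoʳ-< (sumFrom F K (suc M)) (partialSum<nbonacci K) ⟩
      sumFrom F K (suc M) + F (suc M + K)  ≡⟨ +-comm (sumFrom F K (suc M)) _ ⟩
      sumFrom F K N                        ≤⟨ m≤m+n _ _ ⟩
      sumFrom F K N + value F w            ≡⟨ value-ones-++ F N w ⟨
      value F (ones N ++ w)                ∎
      where
      K = length w
      |p|≡ : length p ≡ suc M + K
      |p|≡ = suc-injective (≡.trans (≡.sym |t|≡) (length-replicate-++ N w))

    noRun-reachable : ∀ d → ∃ λ t → CarryStep* N (false ∷ true ∷ d) t × NoRunOf N t
    noRun-reachable d with normalise (s≤s (s≤s z≤n)) (false ∷ true ∷ d)
    ... | t , steps , free = t , steps , carryFree-noRun t free noLeadingRun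
      where
      noLeadingRun : ¬ StartsWithRun N t
      noLeadingRun run = <-irrefl
        (Star-invariant (≡.setoid ℕ) (value F) (value-carry (nbonacci-recurrent (suc M))) steps)
        (run-outweighs (true ∷ d) run (≡.sym (Star-invariant (≡.setoid ℕ) length carry-length steps)))

module Evaluation {c ℓ} (R : CommutativeRing c ℓ) (ρ : CommutativeRing.Carrier R) where
  open CommutativeRing R hiding (zero; refl)
  open Positional semiring
  open import Algebra.Properties.Semiring.Exp semiring using (_^_; ^-homo-*)
  open import Relation.Binary.Reasoning.Setoid setoid

  pow≡^ : ∀ k → pow R ρ k ≡ ρ ^ k
  pow≡^ zero    = refl
  pow≡^ (suc k) = cong (ρ *_) (pow≡^ k)

  pow-+ : ∀ m k → pow R ρ (m ℕ.+ k) ≈ pow R ρ m * pow R ρ k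
  pow-+ m k = begin
    pow R ρ (m ℕ.+ k)     ≡⟨ pow≡^ (m ℕ.+ k) ⟩
    ρ ^ (m ℕ.+ k)         ≈⟨ ^-homo-* ρ m k ⟩
    ρ ^ m * ρ ^ k         ≡⟨ cong₂ _*_ (pow≡^ m) (pow≡^ k) ⟨
    pow R ρ m * pow R ρ k ∎

  sumFrom-pow : ∀ k m → sumFrom (pow R ρ) k m ≈ geomSum R ρ m * pow R ρ k
  sumFrom-pow k zero    = sym (zeroˡ _)
  sumFrom-pow k (suc m) = begin
    pow R ρ (m ℕ.+ k) + sumFrom (pow R ρ) k m         ≈⟨ +-cong (pow-+ m k) (sumFrom-pow k m) ⟩
    pow R ρ m * pow R ρ k + geomSum R ρ m * pow R ρ k ≈⟨ distribʳ _ _ _ ⟨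
    (pow R ρ m + geomSum R ρ m) * pow R ρ k           ∎

  pow-recurrent : ∀ {N} → pow R ρ N ≈ geomSum R ρ N → Recurrent N (pow R ρ)
  pow-recurrent {N} root k = begin
    pow R ρ (N ℕ.+ k)         ≈⟨ pow-+ N k ⟩
    pow R ρ N * pow R ρ k     ≈⟨ *-congʳ root ⟩
    geomSum R ρ N * pow R ρ k ≈⟨ sumFrom-pow k N ⟨
    sumFrom (pow R ρ) k N     ∎

  eval≡value : ∀ s → eval R ρ s ≡ value (pow R ρ) s
  eval≡value []          = refl
  eval≡value (b ∷ s) = cong₂ _+_ (cong (_* pow R ρ (length s)) (bit≡digit b)) (eval≡value s)
    where
    bit≡digit : ∀ b → bit R b ≡ digit b
    bit≡digit true  = refl
    bit≡digit false = refl

  eval-zeros-++ : ∀ m s → eval R ρ (zeros m ++ s) ≈ eval R ρ s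
  eval-zeros-++ m s = begin
    eval R ρ (zeros m ++ s)          ≡⟨ eval≡value (zeros m ++ s) ⟩
    value (pow R ρ) (zeros m ++ s)   ≈⟨ value-zeros-++ (pow R ρ) m s ⟩
    value (pow R ρ) s                ≡⟨ eval≡value s ⟨
    eval R ρ s                       ∎

  eval-carry* : ∀ {N s t} → pow R ρ N ≈ geomSum R ρ N → CarryStep* N s t → eval R ρ s ≈ eval R ρ t
  eval-carry* {N} {s} {t} root steps = begin
    eval R ρ s        ≡⟨ eval≡value s ⟩
    value (pow R ρ) s ≈⟨ Star-invariant setoid (value (pow R ρ)) (value-carry (pow-recurrent {N} root)) steps ⟩
    value (pow R ρ) t ≡⟨ eval≡value t ⟨
    eval R ρ t        ∎

  normalForm-of : ∀ {N n x t} → OneInFirstTwo t → NoRunOf N t → length t ≡ suc (suc n) →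
                  eval R ρ t ≈ x →
                  Σ (List Bool) λ cs →
                    NormalForm N cs × (length cs ≡ n ⊎ length cs ≡ suc n) × eval R ρ (true ∷ cs) ≈ x
  normalForm-of (1∷ cs)  noRun |t|≡ t≈x = cs , noRun , inj₂ (suc-injective |t|≡) , t≈x
  normalForm-of (01∷ cs) noRun |t|≡ t≈x =
    cs , NoRunOf-tail noRun , inj₁ (suc-injective (suc-injective |t|≡)) ,
    trans (sym (eval-zeros-++ 1 (true ∷ cs))) t≈x

theorem3p8 : ∀ {c ℓ} (R : CommutativeRing c ℓ) (N : ℕ) → 2 ≤ N →
    (ρ : CommutativeRing.Carrier R) →
    CommutativeRing._≈_ R (pow R ρ N) (geomSum R ρ N) →
    (ds : List Bool) (n : ℕ) →
    ¬ CommutativeRing._≈_ R (eval R ρ ds) (CommutativeRing.0# R) →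
    HasDegree ds n →
    Σ (List Bool) λ cs →
      NormalForm N cs ×
      (length cs ≡ n ⊎ length cs ≡ suc n) ×
      CommutativeRing._≈_ R (eval R ρ (true ∷ cs)) (eval R ρ ds)
theorem3p8 R (suc (suc M)) (s≤s (s≤s z≤n)) ρ root ds n _ deg with HasDegree-view ds deg
... | k , d , refl , refl with NBonacciWeight.noRun-reachable M d
... | t , steps , noRun =
  normalForm-of (Star-respects OneInFirstTwo oneInFirstTwo-carry steps (01∷ d)) noRun
    (≡.sym (Star-invariant (≡.setoid ℕ) length carry-length steps))
    (begin
      eval R ρ t                      ≈⟨ eval-carry* root steps ⟨
      eval R ρ (false ∷ true ∷ d)     ≈⟨ eval-zeros-++ 1 (true ∷ d) ⟩
      eval R ρ (true ∷ d)             ≈⟨ eval-zeros-++ k (true ∷ d) ⟨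
      eval R ρ (zeros k ++ true ∷ d)  ∎)
  where
  open Evaluation R ρ
  open import Relation.Binary.Reasoning.Setoid (CommutativeRing.setoid R)
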